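{- $\mathrm{ex}'(n,\{\text{nested},\text{crossing},\text{ears}\})\in O(n)$.
   Context: Let $P$ be a set of $n$ points in convex position in the plane (the vertices of a convex $n$-gon); a triangle on $P$ is a 3-element subset of $P$. For two distinct triangles $t_1,t_2$ on $P$, label each point of $t_1\cup t_2$ by the triangle(s) containing it and read the points in their cyclic order around the polygon. The pair forms exactly one of eight configurations. (i) If $t_1,t_2$ share two vertices $u,v$: "taco" if their third vertices lie on the same side of the line $uv$, "mariposa" if on opposite sides. (ii) If they share exactly one vertex $v$: read the remaining four vertices in cyclic order starting just after $v$; "bat" if the pattern is $t_1t_1t_2t_2$ or $t_2t_2t_1t_1$, "nested" if it is $t_1t_2t_2t_1$ or $t_2t_1t_1t_2$, "crossing" if it is $t_1t_2t_1t_2$ or $t_2t_1t_2t_1$. (iii) If they share no vertex, the cyclic sequence of the six labels is, up to rotation, reflection and exchanging the roles of $t_1,t_2$, one of: "ears" $AAABBB$, "swords" $AABABB$, "david" $ABABAB$. Top/bottom variant: partition the vertices of the convex $n$-gon by a horizontal line into a top half of $\lceil n/2\rceil$ vertices and a bottom half of $\lfloor n/2\rfloor$ vertices (each half consisting of consecutive vertices along the polygon). For a set $X$ of configurations, $\mathrm{ex}'(n,X)$ is the maximum size of a family of triangles on $P$, each having exactly two vertices in the top half and one vertex in the bottom half, in which no two triangles form a configuration belonging to $X$. -}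

module Defs where

open import Data.Nat using (ℕ; zero; suc; _+_; _*_; _∸_; _≤_; _<_; _<ᵇ_; _≡ᵇ_; _≤ᵇ_; ⌈_/2⌉)
open import Data.Bool using (Bool; true; false; if_then_else_)
open import Data.List using (List; []; _∷_; _++_; map; length)
open import Data.List.Membership.Propositional using (_∈_)
open import Data.List.Relation.Unary.All using (All)
open import Data.Product using (_×_; ∃-syntax; _,_)
open import Data.Sum using (_⊎_)
open import Relation.Nullary using (¬_)
open import Relation.Binary.PropositionalEquality using (_≡_; _≢_)

-- The n points of P are 0,1,…,n-1, listed in cyclic order around the
-- convex polygon. A triangle is stored by its vertices in increasing
-- order a < b < c (so triangles, as 3-element subsets, correspond
-- bijectively to such records).
record Tri : Set where
  constructor tri
  field
    a b c : ℕ
open Tri public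

IsTri : ℕ → Tri → Set
IsTri n t = a t < b t × b t < c t × c t < n

isTop : ℕ → ℕ → ℕ
isTop n x = if x <ᵇ ⌈ n /2⌉ then 1 else 0

TopBottom : ℕ → Tri → Set
TopBottom n t = isTop n (a t) + isTop n (b t) + isTop n (c t) ≡ 2

memb : ℕ → Tri → ℕ
memb x t = if (x ≡ᵇ a t) then 1 else (if (x ≡ᵇ b t) then 1 else (if (x ≡ᵇ c t) then 1 else 0))

sharedCount : Tri → Tri → ℕ
sharedCount t₁ t₂ = memb (a t₁) t₂ + memb (b t₁) t₂ + memb (c t₁) t₂

-- Labels (true = t₁, false = t₂) of the union of two increasingly sorted
-- lists of keys, read in increasing order.
mergeLabels : List ℕ → List ℕ → List Bool
mergeLabels [] ys = map (λ _ → false) ys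
mergeLabels (x ∷ xs) [] = true ∷ map (λ _ → true) xs
mergeLabels (x ∷ xs) (y ∷ ys) =
  if x <ᵇ y then true ∷ mergeLabels xs (y ∷ ys) else false ∷ mergeLabels (x ∷ xs) ys

sort2 : ℕ → ℕ → List ℕ
sort2 x y = if x ≤ᵇ y then x ∷ y ∷ [] else y ∷ x ∷ []

Split : Tri → ℕ → ℕ → ℕ → Set
Split t v p q = (v ≡ a t × p ≡ b t × q ≡ c t)
              ⊎ (v ≡ b t × p ≡ a t × q ≡ c t)
              ⊎ (v ≡ c t × p ≡ a t × q ≡ b t)

-- position of x in the cyclic order starting just after v (v itself ↦ 0)
cycKey : ℕ → ℕ → ℕ → ℕ
cycKey n v x = if v ≤ᵇ x then x ∸ v else x + n ∸ v

-- the label pattern of the four non-shared vertices, read in cyclic order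
-- starting just after the unique shared vertex v
OneSharedPattern : ℕ → Tri → Tri → List Bool → Set
OneSharedPattern n t₁ t₂ pat =
  sharedCount t₁ t₂ ≡ 1 ×
  ∃[ v ] ∃[ p ] ∃[ q ] ∃[ r ] ∃[ s ]
    (Split t₁ v p q × Split t₂ v r s ×
     mergeLabels (sort2 (cycKey n v p) (cycKey n v q))
                 (sort2 (cycKey n v r) (cycKey n v s)) ≡ pat)

T = true
F = false

Nested : ℕ → Tri → Tri → Set
Nested n t₁ t₂ = OneSharedPattern n t₁ t₂ (T ∷ F ∷ F ∷ T ∷ [])
               ⊎ OneSharedPattern n t₁ t₂ (F ∷ T ∷ T ∷ F ∷ [])

Crossing : ℕ → Tri → Tri → Set
Crossing n t₁ t₂ = OneSharedPattern n t₁ t₂ (T ∷ F ∷ T ∷ F ∷ [])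
                 ⊎ OneSharedPattern n t₁ t₂ (F ∷ T ∷ F ∷ T ∷ [])

rot1 : List Bool → List Bool
rot1 [] = []
rot1 (x ∷ xs) = xs ++ (x ∷ [])

rotate : ℕ → List Bool → List Bool
rotate zero xs = xs
rotate (suc k) xs = rotate k (rot1 xs)

sixLabels : Tri → Tri → List Bool
sixLabels t₁ t₂ = mergeLabels (a t₁ ∷ b t₁ ∷ c t₁ ∷ []) (a t₂ ∷ b t₂ ∷ c t₂ ∷ [])

-- no shared vertex, and the cyclic label sequence is AAABBB up to
-- rotation (reflection / swapping A,B only add BBBAAA, included too)
Ears : Tri → Tri → Set
Ears t₁ t₂ = sharedCount t₁ t₂ ≡ 0 ×
  ∃[ k ] (rotate k (sixLabels t₁ t₂) ≡ (T ∷ T ∷ T ∷ F ∷ F ∷ F ∷ [])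
          ⊎ rotate k (sixLabels t₁ t₂) ≡ (F ∷ F ∷ F ∷ T ∷ T ∷ T ∷ []))

ForbiddenX : ℕ → Tri → Tri → Set
ForbiddenX n t₁ t₂ = Nested n t₁ t₂ ⊎ Crossing n t₁ t₂ ⊎ Ears t₁ t₂

XFree : ℕ → List Tri → Set
XFree n fam = ∀ {t₁ t₂} → t₁ ∈ fam → t₂ ∈ fam → t₁ ≢ t₂ → ¬ ForbiddenX n t₁ t₂

module Submission where

-- An admissible triangle (a , b , c), with a < b < c, has its top vertices
-- a < b before h = ⌈n/2⌉ and its bottom vertex c in [h, n): it is "split by h".
-- We show that an X-free family of split triangles has at most 4n members by
-- charging each member injectively to a pair (tag , vertex) ∈ Fin 4 × Fin n.

open import Defs
open import Data.Bool using (Bool; true; false; if_then_else_) renaming (T to IsTrue)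
open import Data.Empty using (⊥; ⊥-elim)
open import Data.Fin using (Fin; fromℕ<; combine)
open import Data.Fin.Patterns using (0F; 1F; 2F; 3F)
import Data.Fin as Fin
open import Data.Fin.Properties using (pigeonhole; combine-injective; fromℕ<-injective)
open import Data.List using (List; []; _∷_; length; lookup)
open import Data.List.Membership.Propositional using (_∈_; lose; find)
open import Data.List.Membership.Propositional.Properties using (∈-lookup)
open import Data.List.Relation.Unary.All as All using (All)
open import Data.List.Relation.Unary.AllPairs using (_∷_)
open import Data.List.Relation.Unary.Any using (Any; any?)
open import Data.List.Relation.Unary.Unique.Propositional using (Unique)
open import Data.Nat using (ℕ; _+_; _*_; _∸_; _≤_; _<_; _<ᵇ_; _≡ᵇ_; _≤ᵇ_; s≤s; ⌈_/2⌉)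
open import Data.Nat.Properties
open import Data.Product using (_×_; _,_; ∃-syntax)
open import Data.Sum as Sum using (_⊎_; inj₁; inj₂)
open import Data.Unit using (tt)
open import Function using (_∘_)
open import Relation.Binary.Definitions using (tri<; tri≈; tri>)
open import Relation.Binary.PropositionalEquality
open import Relation.Nullary using (¬_; yes; no)
open import Relation.Nullary.Decidable using (_×-dec_; ¬?)

if-true : ∀ {A : Set} {b : Bool} {x y : A} → IsTrue b → (if b then x else y) ≡ x
if-true {b = true} _ = refl

if-false : ∀ {A : Set} {b : Bool} {x y : A} → ¬ IsTrue b → (if b then x else y) ≡ y
if-false {b = false} _ = refl
if-false {b = true} ¬t = ⊥-elim (¬t tt)

≥⇒¬<ᵇ : ∀ {m n} → n ≤ m → ¬ IsTrue (m <ᵇ n)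
≥⇒¬<ᵇ {m} {n} n≤m t = ≤⇒≯ n≤m (<ᵇ⇒< m n t)

>⇒¬≤ᵇ : ∀ {m n} → n < m → ¬ IsTrue (m ≤ᵇ n)
>⇒¬≤ᵇ {m} {n} n<m t = <⇒≱ n<m (≤ᵇ⇒≤ m n t)

≢⇒¬≡ᵇ : ∀ {m n} → m ≢ n → ¬ IsTrue (m ≡ᵇ n)
≢⇒¬≡ᵇ {m} {n} m≢n t = m≢n (≡ᵇ⇒≡ m n t)

memb-absent : ∀ {x p q r} → x ≢ p → x ≢ q → x ≢ r → memb x (tri p q r) ≡ 0
memb-absent x≢p x≢q x≢r =
  trans (if-false (≢⇒¬≡ᵇ x≢p)) (trans (if-false (≢⇒¬≡ᵇ x≢q)) (if-false (≢⇒¬≡ᵇ x≢r)))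

memb-first : ∀ {x q r} → memb x (tri x q r) ≡ 1
memb-first {x} = if-true (≡⇒≡ᵇ x x refl)

memb-second : ∀ {x p r} → x ≢ p → memb x (tri p x r) ≡ 1
memb-second {x} x≢p = trans (if-false (≢⇒¬≡ᵇ x≢p)) (if-true (≡⇒≡ᵇ x x refl))

memb-third : ∀ {x p q} → x ≢ p → x ≢ q → memb x (tri p q x) ≡ 1
memb-third {x} x≢p x≢q =
  trans (if-false (≢⇒¬≡ᵇ x≢p)) (trans (if-false (≢⇒¬≡ᵇ x≢q)) (if-true (≡⇒≡ᵇ x x refl)))

merge-< : ∀ {x y} xs ys → x < y → mergeLabels (x ∷ xs) (y ∷ ys) ≡ true ∷ mergeLabels xs (y ∷ ys)
merge-< _ _ x<y = if-true (<⇒<ᵇ x<y)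

merge-> : ∀ {x y} xs ys → y < x → mergeLabels (x ∷ xs) (y ∷ ys) ≡ false ∷ mergeLabels (x ∷ xs) ys
merge-> _ _ y<x = if-false (≥⇒¬<ᵇ (<⇒≤ y<x))

sort2-< : ∀ {x y} → x < y → sort2 x y ≡ x ∷ y ∷ []
sort2-< x<y = if-true (≤⇒≤ᵇ (<⇒≤ x<y))

sort2-> : ∀ {x y} → y < x → sort2 x y ≡ y ∷ x ∷ []
sort2-> y<x = if-false (>⇒¬≤ᵇ y<x)

_≶_ : ℕ → ℕ → Set
x ≶ y = x < y ⊎ y < x

≢⇒≶ : ∀ {x y} → x ≢ y → x ≶ y
≢⇒≶ {x} {y} x≢y with <-cmp x y
... | tri< x<y _ _ = inj₁ x<y
... | tri≈ _ x≡y _ = ⊥-elim (x≢y x≡y)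
... | tri> _ _ y<x = inj₂ y<x

sort2-comm : ∀ {x y} → x ≶ y → sort2 x y ≡ sort2 y x
sort2-comm (inj₁ x<y) = trans (sort2-< x<y) (sym (sort2-> x<y))
sort2-comm (inj₂ y<x) = trans (sort2-> y<x) (sym (sort2-< y<x))

NestedOrCrossingPattern : List Bool → Set
NestedOrCrossingPattern L =
  (L ≡ T ∷ F ∷ F ∷ T ∷ [] ⊎ L ≡ F ∷ T ∷ T ∷ F ∷ []) ⊎
  (L ≡ T ∷ F ∷ T ∷ F ∷ [] ⊎ L ≡ F ∷ T ∷ F ∷ T ∷ [])

-- If both smaller keys precede both larger keys, the merged labels start with
-- one label of each pair and end with one label of each pair: nested or crossing.
interleaved-pattern : ∀ {lo₁ hi₁ lo₂ hi₂} → lo₁ < hi₁ → lo₂ < hi₂ → lo₁ < hi₂ → lo₂ < hi₁ →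
  lo₁ ≶ lo₂ → hi₁ ≶ hi₂ → NestedOrCrossingPattern (mergeLabels (sort2 lo₁ hi₁) (sort2 lo₂ hi₂))
interleaved-pattern {lo₁} {hi₁} {lo₂} {hi₂} lo₁<hi₁ lo₂<hi₂ lo₁<hi₂ lo₂<hi₁ lo hi
  rewrite sort2-< lo₁<hi₁ | sort2-< lo₂<hi₂ = merged lo hi
  where
  merged : lo₁ ≶ lo₂ → hi₁ ≶ hi₂ →
           NestedOrCrossingPattern (mergeLabels (lo₁ ∷ hi₁ ∷ []) (lo₂ ∷ hi₂ ∷ []))
  merged (inj₁ l) (inj₁ h)
    rewrite merge-< (hi₁ ∷ []) (hi₂ ∷ []) l | merge-> [] (hi₂ ∷ []) lo₂<hi₁ | merge-< [] [] h
    = inj₂ (inj₁ refl)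
  merged (inj₁ l) (inj₂ h)
    rewrite merge-< (hi₁ ∷ []) (hi₂ ∷ []) l | merge-> [] (hi₂ ∷ []) lo₂<hi₁ | merge-> [] [] h
    = inj₁ (inj₁ refl)
  merged (inj₂ l) (inj₁ h)
    rewrite merge-> (hi₁ ∷ []) (hi₂ ∷ []) l | merge-< (hi₁ ∷ []) [] lo₁<hi₂ | merge-< [] [] h
    = inj₁ (inj₂ refl)
  merged (inj₂ l) (inj₂ h)
    rewrite merge-> (hi₁ ∷ []) (hi₂ ∷ []) l | merge-< (hi₁ ∷ []) [] lo₁<hi₂ | merge-> [] [] h
    = inj₂ (inj₂ refl)

module _ (n : ℕ) where

  cycKey-from : ∀ {v x} → v ≤ x → cycKey n v x ≡ x ∸ v
  cycKey-from v≤x = if-true (≤⇒≤ᵇ v≤x)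

  cycKey-wrapped : ∀ {v x} → x < v → cycKey n v x ≡ x + n ∸ v
  cycKey-wrapped x<v = if-false (>⇒¬≤ᵇ x<v)

  cycKey-after : ∀ {v x y} → v ≤ x → x < y → cycKey n v x < cycKey n v y
  cycKey-after v≤x x<y
    rewrite cycKey-from v≤x | cycKey-from (≤-trans v≤x (<⇒≤ x<y))
    = ∸-monoˡ-< x<y v≤x

  cycKey-before : ∀ {v x y} → v ≤ n → x < y → y < v → cycKey n v x < cycKey n v y
  cycKey-before {v} {x} v≤n x<y y<v
    rewrite cycKey-wrapped (<-trans x<y y<v) | cycKey-wrapped y<v
    = ∸-monoˡ-< (+-monoˡ-< n x<y) (≤-trans v≤n (m≤n+m n x))

  cycKey-wrap : ∀ {v x y} → v ≤ x → x < n → y < v → cycKey n v x < cycKey n v y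
  cycKey-wrap {v} {x} {y} v≤x x<n y<v
    rewrite cycKey-from v≤x | cycKey-wrapped y<v
    = ∸-monoˡ-< (<-≤-trans x<n (m≤n+m n y)) v≤x

  cycKey-after-≶ : ∀ {v x y} → v ≤ x → v ≤ y → x ≶ y → cycKey n v x ≶ cycKey n v y
  cycKey-after-≶ v≤x v≤y = Sum.map (cycKey-after v≤x) (cycKey-after v≤y)

  cycKey-before-≶ : ∀ {v x y} → v ≤ n → x < v → y < v → x ≶ y → cycKey n v x ≶ cycKey n v y
  cycKey-before-≶ v≤n x<v y<v = Sum.map (λ x<y → cycKey-before v≤n x<y y<v) (λ y<x → cycKey-before v≤n y<x x<v)

  one-shared-forbidden : ∀ {t₁ t₂ v p q r s} → sharedCount t₁ t₂ ≡ 1 → Split t₁ v p q → Split t₂ v r s →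
    NestedOrCrossingPattern (mergeLabels (sort2 (cycKey n v p) (cycKey n v q)) (sort2 (cycKey n v r) (cycKey n v s))) →
    ForbiddenX n t₁ t₂
  one-shared-forbidden one s₁ s₂ (inj₁ (inj₁ e)) = inj₁ (inj₁ (one , _ , _ , _ , _ , _ , s₁ , s₂ , e))
  one-shared-forbidden one s₁ s₂ (inj₁ (inj₂ e)) = inj₁ (inj₂ (one , _ , _ , _ , _ , _ , s₁ , s₂ , e))
  one-shared-forbidden one s₁ s₂ (inj₂ (inj₁ e)) = inj₂ (inj₁ (inj₁ (one , _ , _ , _ , _ , _ , s₁ , s₂ , e)))
  one-shared-forbidden one s₁ s₂ (inj₂ (inj₂ e)) = inj₂ (inj₁ (inj₂ (one , _ , _ , _ , _ , _ , s₁ , s₂ , e)))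

record Split-by (h n : ℕ) (t : Tri) : Set where
  field
    a<b : a t < b t
    b<h : b t < h
    h≤c : h ≤ c t
    c<n : c t < n

open Split-by

top<bottom : ∀ {h n t t'} → Split-by h n t → Split-by h n t' → b t < c t'
top<bottom st st' = <-≤-trans (b<h st) (h≤c st')

b<c : ∀ {h n t} → Split-by h n t → b t < c t
b<c st = top<bottom st st

a<c : ∀ {h n t} → Split-by h n t → a t < c t
a<c st = <-trans (a<b st) (b<c st)

b<n : ∀ {h n t} → Split-by h n t → b t < n
b<n st = <-trans (b<c st) (c<n st)

module Configurations {h n : ℕ} where

  shared-left : ∀ {a b c b' c'} → Split-by h n (tri a b c) → Split-by h n (tri a b' c') →
    b ≢ b' → c ≢ c' → ForbiddenX n (tri a b c) (tri a b' c')
  shared-left {a} {b} {c} {b'} {c'} s s' b≢b' c≢c' =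
    one-shared-forbidden n shared (inj₁ (refl , refl , refl)) (inj₁ (refl , refl , refl))
      (interleaved-pattern (key-after a≤b (b<c s)) (key-after a≤b' (b<c s'))
        (key-after a≤b (top<bottom s s')) (key-after a≤b' (top<bottom s' s))
        (cycKey-after-≶ n a≤b a≤b' (≢⇒≶ b≢b'))
        (cycKey-after-≶ n (<⇒≤ (a<c s)) (<⇒≤ (a<c s')) (≢⇒≶ c≢c')))
    where
    key-after : ∀ {x y} → a ≤ x → x < y → cycKey n a x < cycKey n a y
    key-after = cycKey-after n
    a≤b : a ≤ b
    a≤b = <⇒≤ (a<b s)
    a≤b' : a ≤ b'
    a≤b' = <⇒≤ (a<b s')
    shared : sharedCount (tri a b c) (tri a b' c') ≡ 1
    shared = cong₂ _+_
      (cong₂ _+_ (memb-first {a})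
                 (memb-absent (>⇒≢ (a<b s)) b≢b' (<⇒≢ (top<bottom s s'))))
      (memb-absent (>⇒≢ (a<c s)) (>⇒≢ (top<bottom s' s)) c≢c')

  shared-right : ∀ {a b c a' c'} → Split-by h n (tri a b c) → Split-by h n (tri a' b c') →
    a ≢ a' → c ≢ c' → ForbiddenX n (tri a b c) (tri a' b c')
  shared-right {a} {b} {c} {a'} {c'} s s' a≢a' c≢c' =
    one-shared-forbidden n shared (inj₂ (inj₁ (refl , refl , refl))) (inj₂ (inj₁ (refl , refl , refl)))
      (subst₂ (λ P Q → NestedOrCrossingPattern (mergeLabels P Q))
        (sort2-comm (inj₁ c<a)) (sort2-comm (inj₁ c'<a'))
        (interleaved-pattern c<a c'<a' (wrap s (a<b s')) (wrap s' (a<b s))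
          (cycKey-after-≶ n (<⇒≤ (b<c s)) (<⇒≤ (b<c s')) (≢⇒≶ c≢c'))
          (cycKey-before-≶ n (<⇒≤ (b<n s)) (a<b s) (a<b s') (≢⇒≶ a≢a'))))
    where
    wrap : ∀ {t x} → Split-by h n t → x < b → cycKey n b (Tri.c t) < cycKey n b x
    wrap st = cycKey-wrap n (<⇒≤ (top<bottom s st)) (c<n st)
    c<a : cycKey n b c < cycKey n b a
    c<a = wrap s (a<b s)
    c'<a' : cycKey n b c' < cycKey n b a'
    c'<a' = wrap s' (a<b s')
    shared : sharedCount (tri a b c) (tri a' b c') ≡ 1
    shared = cong₂ _+_
      (cong₂ _+_ (memb-absent a≢a' (<⇒≢ (a<b s)) (<⇒≢ (<-trans (a<b s) (b<c s'))))
                 (memb-second (>⇒≢ (a<b s'))))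
      (memb-absent (>⇒≢ (<-trans (a<b s') (b<c s))) (>⇒≢ (b<c s)) c≢c')

  right-meets-left : ∀ {a v c b' c'} → Split-by h n (tri a v c) → Split-by h n (tri v b' c') →
    c < c' → ForbiddenX n (tri a v c) (tri v b' c')
  right-meets-left {a} {v} {c} {b'} {c'} s s' c<c' =
    one-shared-forbidden n shared (inj₂ (inj₁ (refl , refl , refl))) (inj₁ (refl , refl , refl))
      (subst (λ P → NestedOrCrossingPattern (mergeLabels P (sort2 _ _)))
        (sort2-comm (inj₁ c<a))
        (interleaved-pattern c<a (key-after v≤b' (b<c s')) (key-after v≤c c<c') b'<a
          (inj₂ (key-after v≤b' (top<bottom s' s))) (inj₂ (wrap s'))))
    where
    key-after : ∀ {x y} → v ≤ x → x < y → cycKey n v x < cycKey n v y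
    key-after = cycKey-after n
    v≤b' : v ≤ b'
    v≤b' = <⇒≤ (a<b s')
    v≤c : v ≤ c
    v≤c = <⇒≤ (b<c s)
    wrap : ∀ {t} → Split-by h n t → cycKey n v (Tri.c t) < cycKey n v a
    wrap st = cycKey-wrap n (<⇒≤ (top<bottom s st)) (c<n st) (a<b s)
    c<a : cycKey n v c < cycKey n v a
    c<a = wrap s
    b'<a : cycKey n v b' < cycKey n v a
    b'<a = cycKey-wrap n v≤b' (b<n s') (a<b s)
    shared : sharedCount (tri a v c) (tri v b' c') ≡ 1
    shared = cong₂ _+_
      (cong₂ _+_ (memb-absent (<⇒≢ (a<b s)) (<⇒≢ (<-trans (a<b s) (a<b s'))) (<⇒≢ (<-trans (a<c s) c<c')))
                 (memb-first {v}))
      (memb-absent (>⇒≢ (b<c s)) (>⇒≢ (top<bottom s' s)) (<⇒≢ c<c'))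

  shared-bottom : ∀ {a b a' b' c} → Split-by h n (tri a b c) → Split-by h n (tri a' b' c) →
    a ≢ a' → b ≢ b' → a < b' → a' < b → ForbiddenX n (tri a b c) (tri a' b' c)
  shared-bottom {a} {b} {a'} {b'} {c} s s' a≢a' b≢b' a<b' a'<b =
    one-shared-forbidden n shared (inj₂ (inj₂ (refl , refl , refl))) (inj₂ (inj₂ (refl , refl , refl)))
      (interleaved-pattern (before (a<b s) (b<c s)) (before (a<b s') (b<c s'))
        (before a<b' (b<c s')) (before a'<b (b<c s))
        (cycKey-before-≶ n c≤n (a<c s) (a<c s') (≢⇒≶ a≢a'))
        (cycKey-before-≶ n c≤n (b<c s) (b<c s') (≢⇒≶ b≢b')))
    where
    c≤n : c ≤ n
    c≤n = <⇒≤ (c<n s)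
    before : ∀ {x y} → x < y → y < c → cycKey n c x < cycKey n c y
    before = cycKey-before n c≤n
    shared : sharedCount (tri a b c) (tri a' b' c) ≡ 1
    shared = cong₂ _+_
      (cong₂ _+_ (memb-absent a≢a' (<⇒≢ a<b') (<⇒≢ (a<c s)))
                 (memb-absent (>⇒≢ a'<b) b≢b' (<⇒≢ (b<c s))))
      (memb-third (>⇒≢ (a<c s')) (>⇒≢ (b<c s')))

  -- Disjoint triangles whose vertex sets are cyclic intervals: ears.
  ears : ∀ {a b c a' b' c'} → Split-by h n (tri a b c) → Split-by h n (tri a' b' c') →
    b < a' → c' < c → Ears (tri a b c) (tri a' b' c')
  ears {a} {b} {c} {a'} {b'} {c'} s s' b<a' c'<c = shared , 2 , inj₂ (cong (rotate 2) labels)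
    where
    a<a' : a < a'
    a<a' = <-trans (a<b s) b<a'
    shared : sharedCount (tri a b c) (tri a' b' c') ≡ 0
    shared = cong₂ _+_
      (cong₂ _+_ (memb-absent (<⇒≢ a<a') (<⇒≢ (<-trans a<a' (a<b s'))) (<⇒≢ (<-trans a<a' (a<c s'))))
                 (memb-absent (<⇒≢ b<a') (<⇒≢ (<-trans b<a' (a<b s'))) (<⇒≢ (<-trans b<a' (a<c s')))))
      (memb-absent (>⇒≢ (<-trans (a<c s') c'<c)) (>⇒≢ (top<bottom s' s)) (>⇒≢ c'<c))
    labels : sixLabels (tri a b c) (tri a' b' c') ≡ T ∷ T ∷ F ∷ F ∷ F ∷ T ∷ []
    labels = begin
      mergeLabels (a ∷ b ∷ c ∷ []) (a' ∷ b' ∷ c' ∷ [])  ≡⟨ merge-< (b ∷ c ∷ []) (b' ∷ c' ∷ []) a<a' ⟩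
      T ∷ mergeLabels (b ∷ c ∷ []) (a' ∷ b' ∷ c' ∷ [])  ≡⟨ cong (T ∷_) (merge-< (c ∷ []) (b' ∷ c' ∷ []) b<a') ⟩
      T ∷ T ∷ mergeLabels (c ∷ []) (a' ∷ b' ∷ c' ∷ [])  ≡⟨ cong (λ L → T ∷ T ∷ L) (merge-> [] (b' ∷ c' ∷ []) a'<c) ⟩
      T ∷ T ∷ F ∷ mergeLabels (c ∷ []) (b' ∷ c' ∷ [])   ≡⟨ cong (λ L → T ∷ T ∷ F ∷ L) (merge-> [] (c' ∷ []) (top<bottom s' s)) ⟩
      T ∷ T ∷ F ∷ F ∷ mergeLabels (c ∷ []) (c' ∷ [])    ≡⟨ cong (λ L → T ∷ T ∷ F ∷ F ∷ L) (merge-> [] [] c'<c) ⟩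
      T ∷ T ∷ F ∷ F ∷ F ∷ T ∷ []                        ∎
      where
      open ≡-Reasoning
      a'<c : a' < c
      a'<c = <-trans (a<c s') c'<c

module _ {A : Set} where

  unique-lookup : ∀ {xs : List A} → Unique xs → (i j : Fin (length xs)) → i Fin.< j → lookup xs i ≢ lookup xs j
  unique-lookup (x∉xs ∷ _) Fin.zero (Fin.suc j) _ = All.lookup x∉xs (∈-lookup j)
  unique-lookup (_ ∷ u) (Fin.suc i) (Fin.suc j) (s≤s i<j) = unique-lookup u i j i<j

  -- Otherwise two positions would receive the same code.
  injection-bound : ∀ {m} {xs : List A} → Unique xs → (f : ∀ {x} → x ∈ xs → Fin m) →
    (∀ {x y} (p : x ∈ xs) (q : y ∈ xs) → f p ≡ f q → x ≡ y) → length xs ≤ m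
  injection-bound {m} {xs} u f f-inj with length xs ≤? m
  ... | yes bound = bound
  ... | no ¬bound with pigeonhole (≰⇒> ¬bound) (λ i → f (∈-lookup {xs = xs} i))
  ... | i , j , i<j , same = ⊥-elim (unique-lookup u i j i<j (f-inj (∈-lookup i) (∈-lookup j) same))

module Charging (h n : ℕ) (fam : List Tri) (split : ∀ {t} → t ∈ fam → Split-by h n t)
                (free : XFree n fam) where

  open Configurations {h} {n}

  differ-at : ∀ (f : Tri → ℕ) {t t'} → f t ≢ f t' → t ≢ t'
  differ-at f f≢ t≡t' = f≢ (cong f t≡t')

  Dominated : Tri → Set
  Dominated t = Any (λ x → a x ≡ a t × b x ≡ b t × c t < c x) fam

  LeftPartner : Tri → Set
  LeftPartner t = Any (λ x → a x ≡ a t × b x ≢ b t) fam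

  RightPartner : Tri → Set
  RightPartner t = Any (λ x → b x ≡ b t × a x ≢ a t) fam

  -- Two dominated members with the same bottom vertex coincide; by symmetry we
  -- may assume the first has the smaller left top vertex.
  dominated-same-bottom-≤ : ∀ {a b c a' b' c₁ c₂} →
    tri a b c ∈ fam → tri a' b' c ∈ fam → tri a b c₁ ∈ fam → tri a' b' c₂ ∈ fam →
    c < c₁ → c < c₂ → a ≤ a' → tri a b c ≡ tri a' b' c
  dominated-same-bottom-≤ {b = b} {b' = b'} m m' m₁ m₂ c<c₁ c<c₂ a≤a' with m≤n⇒m<n∨m≡n a≤a'
  ... | inj₂ refl with b ≟ b'
  ...   | yes refl = refl
  ...   | no b≢b' = ⊥-elim (free m₁ m' (differ-at Tri.b b≢b')
                      (shared-left (split m₁) (split m') b≢b' (>⇒≢ c<c₁)))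
  dominated-same-bottom-≤ {b = b} {a' = a'} {b' = b'} m m' m₁ m₂ c<c₁ c<c₂ a≤a' | inj₁ a<a' with <-cmp b a'
  ... | tri< b<a' _ _ = ⊥-elim (free m₁ m' (differ-at Tri.a (<⇒≢ a<a'))
                          (inj₂ (inj₂ (ears (split m₁) (split m') b<a' c<c₁))))
  ... | tri≈ _ refl _ = ⊥-elim (free m m₂ (differ-at Tri.a (<⇒≢ (a<b (split m))))
                          (right-meets-left (split m) (split m₂) c<c₂))
  ... | tri> _ _ a'<b with b ≟ b'
  ...   | yes refl = ⊥-elim (free m₁ m' (differ-at Tri.a (<⇒≢ a<a'))
                       (shared-right (split m₁) (split m') (<⇒≢ a<a') (>⇒≢ c<c₁)))
  ...   | no b≢b' = ⊥-elim (free m m' (differ-at Tri.a (<⇒≢ a<a'))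
                      (shared-bottom (split m) (split m') (<⇒≢ a<a') b≢b'
                        (<-trans a<a' (a<b (split m'))) a'<b))

  dominated-same-bottom : ∀ {t t'} → t ∈ fam → t' ∈ fam → Dominated t → Dominated t' →
    c t ≡ c t' → t ≡ t'
  dominated-same-bottom {tri a _ _} {tri a' _ _} m m' d d' refl with find d | find d'
  ... | tri _ _ c₁ , m₁ , refl , refl , c<c₁ | tri _ _ c₂ , m₂ , refl , refl , c<c₂ with ≤-total a a'
  ...   | inj₁ a≤a' = dominated-same-bottom-≤ m m' m₁ m₂ c<c₁ c<c₂ a≤a'
  ...   | inj₂ a'≤a = sym (dominated-same-bottom-≤ m' m m₂ m₁ c<c₂ c<c₁ a'≤a)

  undominated-same-top : ∀ {a b c c'} → tri a b c ∈ fam → tri a b c' ∈ fam →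
    ¬ Dominated (tri a b c) → ¬ Dominated (tri a b c') → tri a b c ≡ tri a b c'
  undominated-same-top {c = c} {c'} m m' ¬d ¬d' with <-cmp c c'
  ... | tri≈ _ refl _ = refl
  ... | tri< c<c' _ _ = ⊥-elim (¬d (lose m' (refl , refl , c<c')))
  ... | tri> _ _ c'<c = ⊥-elim (¬d' (lose m (refl , refl , c'<c)))

  no-right-partner : ∀ {a b c b' c' a₁ c₁} → tri a b c ∈ fam → tri a b' c' ∈ fam →
    tri a₁ b c₁ ∈ fam → a₁ ≢ a → b < b' → ⊥
  no-right-partner {c = c} {c' = c'} {c₁ = c₁} m m' m₁ a₁≢a b<b' with c₁ ≟ c
  ... | no c₁≢c = free m m₁ (differ-at Tri.a (a₁≢a ∘ sym))
                    (shared-right (split m) (split m₁) (a₁≢a ∘ sym) (c₁≢c ∘ sym))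
  ... | yes refl with c ≟ c'
  ...   | no c≢c' = free m m' (differ-at Tri.b (<⇒≢ b<b'))
                      (shared-left (split m) (split m') (<⇒≢ b<b') c≢c')
  ...   | yes refl = free m₁ m' (differ-at Tri.a a₁≢a)
                       (shared-bottom (split m₁) (split m') a₁≢a (<⇒≢ b<b')
                         (<-trans (a<b (split m₁)) b<b') (a<b (split m)))

  data Charge (t : Tri) : Fin 4 → Set where
    dominated     : Dominated t → Charge t 0F
    lone-left     : ¬ Dominated t → ¬ LeftPartner t → Charge t 1F
    lone-right    : ¬ Dominated t → ¬ RightPartner t → Charge t 2F
    right-partner : ¬ Dominated t → RightPartner t → Charge t 3F

  classify : ∀ t → ∃[ i ] Charge t i
  classify t with any? (λ x → (a x ≟ a t) ×-dec (b x ≟ b t) ×-dec (c t <? c x)) fam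
  ... | yes d = 0F , dominated d
  ... | no ¬d with any? (λ x → (a x ≟ a t) ×-dec ¬? (b x ≟ b t)) fam
  ...   | no ¬l = 1F , lone-left ¬d ¬l
  ...   | yes _ with any? (λ x → (b x ≟ b t) ×-dec ¬? (a x ≟ a t)) fam
  ...     | no ¬r = 2F , lone-right ¬d ¬r
  ...     | yes r = 3F , right-partner ¬d r

  chargedVertex : ∀ {t i} → Charge t i → ℕ
  chargedVertex {t} (dominated _)       = c t
  chargedVertex {t} (lone-left _ _)     = a t
  chargedVertex {t} (lone-right _ _)    = b t
  chargedVertex {t} (right-partner _ _) = a t

  chargedVertex<n : ∀ {t i} → t ∈ fam → (x : Charge t i) → chargedVertex x < n
  chargedVertex<n m (dominated _)       = c<n (split m)
  chargedVertex<n m (lone-left _ _)     = <-trans (a<c (split m)) (c<n (split m))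
  chargedVertex<n m (lone-right _ _)    = b<n (split m)
  chargedVertex<n m (right-partner _ _) = <-trans (a<c (split m)) (c<n (split m))

  charge-injective : ∀ {t t' i} → t ∈ fam → t' ∈ fam → (x : Charge t i) (y : Charge t' i) →
    chargedVertex x ≡ chargedVertex y → t ≡ t'
  charge-injective m m' (dominated d) (dominated d') same = dominated-same-bottom m m' d d' same
  charge-injective {tri _ b _} {tri _ b' _} m m' (lone-left ¬d ¬l) (lone-left ¬d' _) refl with b' ≟ b
  ... | no b'≢b = ⊥-elim (¬l (lose m' (refl , b'≢b)))
  ... | yes refl = undominated-same-top m m' ¬d ¬d'
  charge-injective {tri a _ _} {tri a' _ _} m m' (lone-right ¬d ¬r) (lone-right ¬d' _) refl with a' ≟ a
  ... | no a'≢a = ⊥-elim (¬r (lose m' (refl , a'≢a)))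
  ... | yes refl = undominated-same-top m m' ¬d ¬d'
  charge-injective {tri _ b _} {tri _ b' _} m m' (right-partner ¬d r) (right-partner ¬d' _) refl
    with <-cmp b b'
  ... | tri≈ _ refl _ = undominated-same-top m m' ¬d ¬d'
  ... | tri< b<b' _ _ with find r
  ...   | tri _ _ _ , m₁ , refl , a₁≢a = ⊥-elim (no-right-partner m m' m₁ a₁≢a b<b')
  charge-injective m m' (right-partner _ _) (right-partner _ r') refl | tri> _ _ b'<b with find r'
  ...   | tri _ _ _ , m₁ , refl , a₁≢a = ⊥-elim (no-right-partner m' m m₁ a₁≢a b'<b)

  code : ∀ {t} → t ∈ fam → Fin (4 * n)
  code {t} m with classify t
  ... | i , x = combine i (fromℕ< (chargedVertex<n m x))

  code-injective : ∀ {t t'} (m : t ∈ fam) (m' : t' ∈ fam) → code m ≡ code m' → t ≡ t'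
  code-injective {t} {t'} m m' same with classify t | classify t'
  ... | i , x | j , y with combine-injective i _ j _ same
  ...   | refl , same-vertex =
          charge-injective m m' x y (fromℕ<-injective _ _ (chargedVertex<n m x) (chargedVertex<n m' y) same-vertex)

  family-bound : Unique fam → length fam ≤ 4 * n
  family-bound u = injection-bound u code code-injective

-- Every admissible triangle is split by ⌈n/2⌉: the bottom vertex c must lie
-- in the bottom half (else all three are top), and then b in the top half
-- (else at most one vertex is top).

isTop-top : ∀ {n x} → x < ⌈ n /2⌉ → isTop n x ≡ 1
isTop-top x<h = if-true (<⇒<ᵇ x<h)

isTop-bottom : ∀ {n x} → ⌈ n /2⌉ ≤ x → isTop n x ≡ 0
isTop-bottom h≤x = if-false (≥⇒¬<ᵇ h≤x)

isTop≢2 : ∀ n x → isTop n x ≢ 2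
isTop≢2 n x with x <ᵇ ⌈ n /2⌉
... | true = λ ()
... | false = λ ()

topBottom-split : ∀ {n t} → IsTri n t → TopBottom n t → Split-by ⌈ n /2⌉ n t
topBottom-split {n} {tri a b c} (a<b , b<c , c<n) two with ⌈ n /2⌉ ≤? c
... | no c≮h = ⊥-elim (three≢two (trans (sym three) two))
  where
  c<h : c < ⌈ n /2⌉
  c<h = ≰⇒> c≮h
  three : isTop n a + isTop n b + isTop n c ≡ 3
  three = cong₂ _+_ (cong₂ _+_ (isTop-top (<-trans (<-trans a<b b<c) c<h)) (isTop-top (<-trans b<c c<h)))
                    (isTop-top c<h)
  three≢two : 3 ≢ 2
  three≢two ()
... | yes h≤c with b <? ⌈ n /2⌉
...   | yes b<h = record { a<b = a<b ; b<h = b<h ; h≤c = h≤c ; c<n = c<n }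
...   | no b≮h = ⊥-elim (isTop≢2 n a only-a)
  where
  open ≡-Reasoning
  only-a : isTop n a ≡ 2
  only-a = begin
    isTop n a                          ≡⟨ sym (+-identityʳ _) ⟩
    isTop n a + 0                      ≡⟨ sym (+-identityʳ _) ⟩
    isTop n a + 0 + 0                  ≡⟨ cong₂ (λ p q → isTop n a + p + q) (sym (isTop-bottom (≮⇒≥ b≮h))) (sym (isTop-bottom h≤c)) ⟩
    isTop n a + isTop n b + isTop n c  ≡⟨ two ⟩
    2                                  ∎

theorem6 : ∃[ C ] ∃[ N ] ∀ (n : ℕ) → N ≤ n → ∀ (fam : List Tri) → Unique fam → All (λ t → IsTri n t × TopBottom n t) fam → XFree n fam → length fam ≤ C * n
theorem6 = 4 , 0 , λ n _ fam unique admissible free →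
  Charging.family-bound ⌈ n /2⌉ n fam (split admissible) free unique
  where
  split : ∀ {n fam} → All (λ t → IsTri n t × TopBottom n t) fam → ∀ {t} → t ∈ fam → Split-by ⌈ n /2⌉ n t
  split admissible t∈fam with All.lookup admissible t∈fam
  ... | isTri , topBottom = topBottom-split isTri topBottom
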